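{- Let $\mathcal{A}_{\mathbf S}$ be a deformation of the braid arrangement in $\mathbb{R}^n$, with $m$ as defined in the context, and let $T\in\mathcal{T}^{(m)}(n)$. Let $X_1,\dots,X_t$ be the maximal cadet sequences of $T$. Then $r_{\mathbf S}(T)=\prod_{j=1}^{t} r_{\mathbf S}(X_j)$.
   Context: A deformation of the braid arrangement in $\mathbb{R}^n$ is a finite set $\mathcal{A}$ of hyperplanes of the form $x_i-x_j=s$ with $1\le i<j\le n$, $s\in\mathbb{Z}$. It is encoded by $\mathbf S=(S_{i,j})_{1\le i<j\le n}$ with $S_{i,j}=\{s:(x_i-x_j=s)\in\mathcal{A}\}$, and written $\mathcal{A}=\mathcal{A}_{\mathbf S}$. For $i<j$ put $S_{j,i}:=S_{i,j}$, $S^-_{i,j}:=\{s\ge0:-s\in S_{i,j}\}$ and $S^-_{j,i}:=\{0\}\cup\{s>0:s\in S_{i,j}\}$. Let $m=\max\{|s|:s\in\bigcup_{i<j}S_{i,j}\}$. $\mathcal{T}^{(m)}(n)$ denotes the set of rooted plane trees in which every vertex is either a node, having exactly $m+1$ children ordered left to right, or a leaf (no children), with exactly $n$ nodes labeled bijectively by $1,\dots,n$ (leaves unlabeled). For a node $u$, $\mathsf{cadet}(u)$ is its rightmost child that is a node, if one exists. For a non-root vertex $v$, $\mathsf{lsib}(v)$ is the number of children (nodes or leaves) of the parent of $v$ lying to the left of $v$. A cadet sequence is a sequence of nodes $(v_1,\dots,v_k)$, $k\ge1$, with $v_p=\mathsf{cadet}(v_{p-1})$ for $1<p\le k$; it is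 an $\mathbf S$-cadet sequence if moreover $\sum_{p=i+1}^{j}\mathsf{lsib}(v_p)\notin S^-_{v_i,v_j}$ for all $1\le i<j\le k$. A cadet sequence $(v_1,\dots,v_k)$ is maximal if $v_k$ has no cadet and $v_1$ is not the cadet of any node. An $\mathbf S$-boxing of a cadet sequence $X$ (resp. of $T$) is a partition of the nodes of $X$ (resp. of all nodes of $T$) into $\mathbf S$-cadet sequences. The contributions are $r_{\mathbf S}(X)=\sum_{B}(-1)^{k-|B|}$, the sum over $\mathbf S$-boxings $B$ of $X$, where $k$ is the length of $X$ and $|B|$ the number of parts, and $r_{\mathbf S}(T)=\sum_B(-1)^{n-|B|}$, the sum over $\mathbf S$-boxings $B$ of $T$. -}

module Defs where

open import Data.Nat as ℕ using (ℕ; zero; suc; _⊔_)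
open import Data.Integer as ℤ using (ℤ; +_; -_; ∣_∣)
open import Data.Fin as Fin using (Fin; toℕ)
open import Data.Fin.Properties using () renaming (_≟_ to _≟ᶠ_)
open import Data.Bool using (Bool; true; false; _∧_; _∨_; not; if_then_else_)
open import Data.List as List using (List; []; _∷_; _++_; map; concatMap; foldr; length; allFin)
open import Data.Bool.ListAction using (any; all)
open import Data.Vec using (Vec; []; _∷_)
open import Data.Maybe using (Maybe; just; nothing)
open import Data.Product using (_×_; _,_)
open import Relation.Nullary.Decidable using (⌊_⌋)

-- Deformations of the braid arrangement.
-- S i j is the (finite) list of s with (x_i - x_j = s) ∈ 𝒜, used only
-- for toℕ i < toℕ j (entries with i ≥ j are ignored).

Family : ℕ → Set
Family n = Fin n → Fin n → List ℤ

mOf : ∀ {n} → Family n → ℕ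
mOf {n} S = foldr _⊔_ 0
  (concatMap (λ i → concatMap (λ j →
     if ⌊ toℕ i ℕ.<? toℕ j ⌋ then map ∣_∣ (S i j) else []) (allFin n)) (allFin n))

_∈ᵇ_ : ℤ → List ℤ → Bool
z ∈ᵇ xs = any (λ s → ⌊ s ℤ.≟ z ⌋) xs

-- d ∈ S⁻_{a,b}  for d ∈ ℕ (elements of S⁻ are ≥ 0), with
--   S⁻_{i,j} = {s ≥ 0 : -s ∈ S_{i,j}}               for i < j
--   S⁻_{j,i} = {0} ∪ {s > 0 : s ∈ S_{i,j}}          for i < j
inSminus : ∀ {n} → Family n → Fin n → Fin n → ℕ → Bool
inSminus S a b d =
  if ⌊ toℕ a ℕ.<? toℕ b ⌋
  then (- (+ d)) ∈ᵇ S a b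
  else (⌊ d ℕ.≟ 0 ⌋ ∨ (not ⌊ d ℕ.≟ 0 ⌋ ∧ ((+ d) ∈ᵇ S b a)))

lastOf : ∀ {A : Set} → A → List A → A
lastOf x []       = x
lastOf x (y ∷ ys) = lastOf y ys

data Tree (n m : ℕ) : Set where
  leaf : Tree n m
  node : Fin n → Vec (Tree n m) (suc m) → Tree n m

module _ {n m : ℕ} where

  mutual
    labels : Tree n m → List (Fin n)
    labels leaf        = []
    labels (node u cs) = u ∷ labelsV cs

    labelsV : ∀ {k} → Vec (Tree n m) k → List (Fin n)
    labelsV []       = []
    labelsV (c ∷ cs) = labels c ++ labelsV cs

  rootLabel : Tree n m → Maybe (Fin n)
  rootLabel leaf       = nothing
  rootLabel (node u _) = just u

  -- rightmost child which is a node, together with its lsib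
  -- (the number of children to its left); i = position of first entry
  rightmostNode : ∀ {k} → ℕ → Vec (Tree n m) k → Maybe (Fin n × ℕ)
  rightmostNode i [] = nothing
  rightmostNode i (c ∷ cs) with rightmostNode (suc i) cs
  ... | just r  = just r
  ... | nothing with rootLabel c
  ...   | just v  = just (v , i)
  ...   | nothing = nothing

  -- all triples (u , cadet(u) , lsib(cadet(u)))
  mutual
    cadetEdges : Tree n m → List (Fin n × Fin n × ℕ)
    cadetEdges leaf = []
    cadetEdges (node u cs) with rightmostNode 0 cs
    ... | just (v , l) = (u , v , l) ∷ cadetEdgesV cs
    ... | nothing      = cadetEdgesV cs

    cadetEdgesV : ∀ {k} → Vec (Tree n m) k → List (Fin n × Fin n × ℕ)
    cadetEdgesV []       = []
    cadetEdgesV (c ∷ cs) = cadetEdges c ++ cadetEdgesV cs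

  lookupCadet : Fin n → List (Fin n × Fin n × ℕ) → Maybe (Fin n × ℕ)
  lookupCadet u [] = nothing
  lookupCadet u ((w , v , l) ∷ es) =
    if ⌊ u ≟ᶠ w ⌋ then just (v , l) else lookupCadet u es

  cadet : Tree n m → Fin n → Maybe (Fin n × ℕ)
  cadet τ u = lookupCadet u (cadetEdges τ)

  hasCadet : Tree n m → Fin n → Bool
  hasCadet τ u with cadet τ u
  ... | just _  = true
  ... | nothing = false

  isCadetOfSome : Tree n m → Fin n → Bool
  isCadetOfSome τ v = any (λ { (_ , w , _) → ⌊ w ≟ᶠ v ⌋ }) (cadetEdges τ)

  isNode : Tree n m → Fin n → Bool
  isNode τ u = any (λ w → ⌊ w ≟ᶠ u ⌋) (labels τ)

  -- for (v₁ , v₂ , … , v_k): if v_p = cadet(v_{p-1}) for all 1<p≤k,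
  -- return the list ((v₂ , lsib v₂) , … , (v_k , lsib v_k))
  chain : Tree n m → Fin n → List (Fin n) → Maybe (List (Fin n × ℕ))
  chain τ u [] = just []
  chain τ u (v ∷ vs) with cadet τ u
  ... | nothing = nothing
  ... | just (w , l) with ⌊ w ≟ᶠ v ⌋
  ...   | false = nothing
  ...   | true with chain τ v vs
  ...     | nothing = nothing
  ...     | just ps = just ((v , l) ∷ ps)

  isCadetSeq : Tree n m → List (Fin n) → Bool
  isCadetSeq τ []       = false
  isCadetSeq τ (u ∷ us) with chain τ u us
  ... | just _  = isNode τ u
  ... | nothing = false

  -- for fixed v_i = a: check  Σ_{p=i+1}^{j} lsib(v_p) ∉ S⁻_{v_i,v_j} for all j > i
  checkFrom : Family n → Fin n → ℕ → List (Fin n × ℕ) → Bool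
  checkFrom S a acc []             = true
  checkFrom S a acc ((b , l) ∷ ps) =
    not (inSminus S a b (acc ℕ.+ l)) ∧ checkFrom S a (acc ℕ.+ l) ps

  sConditions : Family n → Fin n → List (Fin n × ℕ) → Bool
  sConditions S a []             = true
  sConditions S a ((b , l) ∷ ps) =
    checkFrom S a 0 ((b , l) ∷ ps) ∧ sConditions S b ps

  isSCadetSeq : Family n → Tree n m → List (Fin n) → Bool
  isSCadetSeq S τ []       = false
  isSCadetSeq S τ (u ∷ us) with chain τ u us
  ... | just ps = isNode τ u ∧ sConditions S u ps
  ... | nothing = false

  isMaxCadetSeq : Tree n m → List (Fin n) → Bool
  isMaxCadetSeq τ []       = false
  isMaxCadetSeq τ (u ∷ us) =
    isCadetSeq τ (u ∷ us)
    ∧ not (hasCadet τ (lastOf u us))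
    ∧ not (isCadetOfSome τ u)

insertions : ∀ {A : Set} → A → List A → List (List A)
insertions x []       = (x ∷ []) ∷ []
insertions x (y ∷ ys) = (x ∷ y ∷ ys) ∷ map (y ∷_) (insertions x ys)

perms : ∀ {A : Set} → List A → List (List A)
perms []       = [] ∷ []
perms (x ∷ xs) = concatMap (insertions x) (perms xs)

addToSomeBlock : ∀ {A : Set} → A → List (List A) → List (List (List A))
addToSomeBlock x []       = []
addToSomeBlock x (b ∷ bs) = ((x ∷ b) ∷ bs) ∷ map (b ∷_) (addToSomeBlock x bs)

setPartitions : ∀ {A : Set} → List A → List (List (List A))
setPartitions []       = [] ∷ []
setPartitions (x ∷ xs) =
  concatMap (λ P → ((x ∷ []) ∷ P) ∷ addToSomeBlock x P) (setPartitions xs)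

sumℤ : List ℤ → ℤ
sumℤ = foldr ℤ._+_ (+ 0)

productℤ : List ℤ → ℤ
productℤ = foldr ℤ._*_ (+ 1)

module _ {n m : ℕ} where

  isSBlock : Family n → Tree n m → List (Fin n) → Bool
  isSBlock S τ B = any (isSCadetSeq S τ) (perms B)

  sBoxings : Family n → Tree n m → List (Fin n) → List (List (List (Fin n)))
  sBoxings S τ V = List.filterᵇ (all (isSBlock S τ)) (setPartitions V)

  rSeq : Family n → Tree n m → List (Fin n) → ℤ
  rSeq S τ X =
    sumℤ (map (λ B → ℤ.-1ℤ ℤ.^ (length X ℕ.∸ length B)) (sBoxings S τ X))

  rTree : Family n → Tree n m → ℤ
  rTree S τ =
    sumℤ (map (λ B → ℤ.-1ℤ ℤ.^ (n ℕ.∸ length B)) (sBoxings S τ (labels τ)))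

-- Write r_S(T) as F(V) = Σ_P Π_{b ∈ P} g(b), summed over the set partitions P of the node set V,
-- where g(b) = (-1)^{|b|-1} if the block b can be ordered as an S-cadet sequence and 0 otherwise.
-- Every such F satisfies F(x ∷ xs) = Σ_{S ⊆ xs} g(x ∷ S) F(xs ∖ S); hence F does not depend on
-- the order of V, and F(X ++ C) = F(X) F(C) whenever g vanishes on all blocks meeting both X
-- and C. The cadet links cut the nodes of T into chains, which are exactly the maximal cadet
-- sequences, and an S-cadet sequence never leaves the chain of its first node. So
-- r_S(T) = Π_j F(X_j) = Π_j r_S(X_j).

module Submission where

open import Defs
open import Data.Nat using (ℕ)
open import Data.Integer using (ℤ)
open import Data.Fin using (Fin)
open import Data.Bool using (T)
open import Data.List using (List; map; allFin)
open import Data.List.Membership.Propositional using (_∈_)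
open import Data.List.Relation.Unary.Unique.Propositional using (Unique)
open import Data.List.Relation.Binary.Permutation.Propositional using (_↭_)
open import Function.Bundles using (_⇔_)
open import Relation.Binary.PropositionalEquality using (_≡_)

open import Data.Bool using (Bool; true; false; not; if_then_else_)
open import Data.Bool.ListAction using (any; all)
open import Data.Bool.Properties using (T-∧)
open import Data.Empty using (⊥; ⊥-elim)
open import Data.Fin.Properties using () renaming (_≟_ to _≟ᶠ_)
open import Data.Integer using (0ℤ; -1ℤ; _+_; _*_; _^_)
open import Data.Integer.Properties
  using ( +-identityˡ; +-identityʳ; +-assoc; *-identityˡ; *-assoc; *-zeroˡ; *-zeroʳ
        ; *-distribˡ-+; *-distribʳ-+; ^-distribˡ-+-*; *-1-isCommutativeMonoid
        ; +-commutativeSemigroup; *-commutativeSemigroup)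
open import Algebra.Properties.CommutativeSemigroup +-commutativeSemigroup
  using () renaming (interchange to +-interchange; xy∙z≈xz∙y to +-swapʳ)
open import Algebra.Properties.CommutativeSemigroup *-commutativeSemigroup
  using () renaming (x∙yz≈y∙xz to *-exchange)
open import Data.Integer.Tactic.RingSolver using (solve-∀)
open import Data.List using ([]; _∷_; _++_; [_]; concat; concatMap; length; filterᵇ)
open import Data.List.Membership.Propositional using (find; lose)
open import Data.List.Membership.Propositional.Properties
  using (∈-++⁺ˡ; ∈-++⁺ʳ; ∈-++⁻; ∈-concat⁺; ∈-concat⁺′; ∈-concat⁻′; ∈-concatMap⁻; ∈-map⁺; ∈-map⁻; ∈-∃++)
open import Data.List.Membership.Propositional.Properties.WithK using (unique∧set⇒bag)
open import Data.List.Properties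
  using ( length-++; length-tabulate; ++-identityʳ; ++-assoc; ∷-injectiveʳ; map-++; map-cong; map-∘
        ; concatMap-++; concat-map)
open import Data.List.Relation.Binary.BagAndSetEquality using (∼bag⇒↭)
import Data.List.Relation.Binary.Permutation.Propositional as ↭
open ↭ using (↭⇒↭ₛ; module PermutationReasoning)
open import Data.List.Relation.Binary.Permutation.Propositional.Properties
  using (↭-length; shift; shifts; ++⁺ˡ; ++⁺; ∈-resp-↭; ↭-empty-inv; drop-mid)
  renaming (map⁺ to ↭-map⁺)
import Data.List.Relation.Binary.Permutation.Setoid.Properties as ↭ₛ
open import Data.List.Relation.Unary.All as All using (All; []; _∷_)
import Data.List.Relation.Unary.All.Properties as All
open import Data.List.Relation.Unary.AllPairs using ([]; _∷_)
open import Data.List.Relation.Unary.Any as Any using (Any; here; there)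
open import Data.List.Relation.Unary.Any.Properties using (any⁺; any⁻) renaming (map⁺ to Any-map⁺)
open import Data.List.Relation.Unary.Unique.Propositional.Properties using (allFin⁺)
open import Data.Maybe using (just; nothing)
open import Data.Nat as ℕ using (zero; suc; _≤_; _<_; _∸_; z≤n; s≤s)
open import Data.Nat.ListAction using (sum)
open import Data.Nat.Properties using (≤-refl; ≤-trans; m≤n⇒m≤1+n; m≤n+m; +-suc; +-mono-≤; +-∸-assoc)
open import Data.Product using (_×_; _,_; ∃; proj₁; proj₂; uncurry; map₁; map₂)
open import Data.Sum using (_⊎_; inj₁; inj₂)
open import Data.Vec using (Vec; []; _∷_)
open import Function using (_∘_)
open import Function.Bundles using (mk⇔; Equivalence)
open import Relation.Binary.PropositionalEquality
  using (_≢_; refl; sym; trans; cong; cong₂; subst; setoid; module ≡-Reasoning)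
open import Relation.Nullary using (¬_; yes; no)
open import Relation.Nullary.Decidable using (⌊_⌋; toWitness; fromWitness)

private variable
  A I J : Set

Unique-++⁻ʳ : ∀ (xs : List A) {ys} → Unique (xs ++ ys) → Unique ys
Unique-++⁻ʳ []       u       = u
Unique-++⁻ʳ (x ∷ xs) (_ ∷ u) = Unique-++⁻ʳ xs u

Unique-++⇒disjoint : ∀ (xs : List A) {ys a} → Unique (xs ++ ys) → a ∈ xs → a ∈ ys → ⊥
Unique-++⇒disjoint (x ∷ xs) (x∉ ∷ u) (here refl) a∈ys = All.lookup x∉ (∈-++⁺ʳ xs a∈ys) refl
Unique-++⇒disjoint (x ∷ xs) (_ ∷ u)  (there a∈xs) a∈ys = Unique-++⇒disjoint xs u a∈xs a∈ys

Unique-++⁻ˡ : ∀ (xs : List A) {ys} → Unique (xs ++ ys) → Unique xs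
Unique-++⁻ˡ []       _        = []
Unique-++⁻ˡ (x ∷ xs) (x∉ ∷ u) = All.++⁻ˡ xs x∉ ∷ Unique-++⁻ˡ xs u

Unique-resp-↭ : ∀ {xs ys : List A} → xs ↭ ys → Unique xs → Unique ys
Unique-resp-↭ p = ↭ₛ.Unique-resp-↭ (setoid _) (↭⇒↭ₛ p)

Unique-concat⁻ : ∀ (xss : List (List A)) → Unique (concat xss) → All (λ xs → ∃ (_∈ xs)) xss → Unique xss
Unique-concat⁻ []         _ _                 = []
Unique-concat⁻ (xs ∷ xss) u ((a , a∈xs) ∷ ne) =
  All.tabulate (λ ys∈xss xs≡ys → Unique-++⇒disjoint xs u a∈xs
                  (∈-concat⁺′ (subst (a ∈_) xs≡ys a∈xs) ys∈xss))
  ∷ Unique-concat⁻ xss (Unique-++⁻ʳ xs u) ne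

map-concatMap : ∀ (f : I → A) (g : J → List I) xs → map f (concatMap g xs) ≡ concatMap (map f ∘ g) xs
map-concatMap f g xs = sym (trans (cong concat (map-∘ xs)) (concat-map (map g xs)))

concatMap-++-↭ : ∀ (f g : I → List A) xs →
  concatMap (λ x → f x ++ g x) xs ↭ concatMap f xs ++ concatMap g xs
concatMap-++-↭ f g []       = ↭.refl
concatMap-++-↭ f g (x ∷ xs) = begin
  (f x ++ g x) ++ concatMap (λ x → f x ++ g x) xs  ≡⟨ ++-assoc (f x) (g x) _ ⟩
  f x ++ g x ++ concatMap (λ x → f x ++ g x) xs    ↭⟨ ++⁺ˡ (f x) (++⁺ˡ (g x) (concatMap-++-↭ f g xs)) ⟩
  f x ++ g x ++ concatMap f xs ++ concatMap g xs   ↭⟨ ++⁺ˡ (f x) (shifts (g x) (concatMap f xs)) ⟩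
  f x ++ concatMap f xs ++ g x ++ concatMap g xs   ≡⟨ ++-assoc (f x) (concatMap f xs) _ ⟨
  (f x ++ concatMap f xs) ++ g x ++ concatMap g xs ∎
  where open PermutationReasoning

T⇔T⇒≡ : ∀ {a b} → T a ⇔ T b → a ≡ b
T⇔T⇒≡ {false} {false} _ = refl
T⇔T⇒≡ {false} {true}  e = ⊥-elim (Equivalence.from e _)
T⇔T⇒≡ {true}  {false} e = ⊥-elim (Equivalence.to e _)
T⇔T⇒≡ {true}  {true}  _ = refl

T-not⁺ : ∀ {b} → ¬ T b → T (not b)
T-not⁺ {false} _  = _
T-not⁺ {true}  ¬t = ¬t _

T-not⁻ : ∀ {b} → T (not b) → ¬ T b
T-not⁻ {false} _ ()

∑ : List A → (A → ℤ) → ℤ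
∑ xs f = sumℤ (map f xs)

∑-++ : ∀ xs ys (f : A → ℤ) → ∑ (xs ++ ys) f ≡ ∑ xs f + ∑ ys f
∑-++ []       ys f = sym (+-identityˡ _)
∑-++ (x ∷ xs) ys f = trans (cong (f x +_) (∑-++ xs ys f)) (sym (+-assoc (f x) _ _))

∑-map : ∀ (h : I → A) xs f → ∑ (map h xs) f ≡ ∑ xs (f ∘ h)
∑-map h []       f = refl
∑-map h (x ∷ xs) f = cong (f (h x) +_) (∑-map h xs f)

∑-concatMap : ∀ (k : I → List A) xs f → ∑ (concatMap k xs) f ≡ ∑ xs (λ x → ∑ (k x) f)
∑-concatMap k []       f = refl
∑-concatMap k (x ∷ xs) f =
  trans (∑-++ (k x) (concatMap k xs) f) (cong (∑ (k x) f +_) (∑-concatMap k xs f))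

∑-+ : ∀ xs (f g : A → ℤ) → ∑ xs (λ x → f x + g x) ≡ ∑ xs f + ∑ xs g
∑-+ []       f g = refl
∑-+ (x ∷ xs) f g = trans (cong (f x + g x +_) (∑-+ xs f g)) (+-interchange (f x) (g x) _ _)

∑-*ˡ : ∀ xs (f : A → ℤ) c → ∑ xs (λ x → c * f x) ≡ c * ∑ xs f
∑-*ˡ []       f c = sym (*-zeroʳ c)
∑-*ˡ (x ∷ xs) f c = trans (cong (c * f x +_) (∑-*ˡ xs f c)) (sym (*-distribˡ-+ c (f x) _))

∑-*ʳ : ∀ xs (f : A → ℤ) c → ∑ xs (λ x → f x * c) ≡ ∑ xs f * c
∑-*ʳ []       f c = sym (*-zeroˡ c)
∑-*ʳ (x ∷ xs) f c = trans (cong (f x * c +_) (∑-*ʳ xs f c)) (sym (*-distribʳ-+ c (f x) _))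

∑-congᴬ : ∀ {xs} {f g : A → ℤ} → All (λ x → f x ≡ g x) xs → ∑ xs f ≡ ∑ xs g
∑-congᴬ []       = refl
∑-congᴬ (e ∷ es) = cong₂ _+_ e (∑-congᴬ es)

∑-cong : ∀ xs {f g : A → ℤ} → (∀ x → f x ≡ g x) → ∑ xs f ≡ ∑ xs g
∑-cong xs e = ∑-congᴬ (All.universal e xs)

productℤ-↭ : ∀ {xs ys} → xs ↭ ys → productℤ xs ≡ productℤ ys
productℤ-↭ p = ↭ₛ.foldr-commMonoid (setoid ℤ) *-1-isCommutativeMonoid (↭⇒↭ₛ p)

splits : List A → List (List A × List A)
splits []       = ([] , []) ∷ []
splits (x ∷ xs) = map (map₂ (x ∷_)) (splits xs) ++ map (map₁ (x ∷_)) (splits xs)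

∑split : List A → (List A → List A → ℤ) → ℤ
∑split xs φ = ∑ (splits xs) (uncurry φ)

place : A → (List A → List A → ℤ) → List A → List A → ℤ
place x φ S R = φ S (x ∷ R) + φ (x ∷ S) R

∑split-∷ : ∀ (x : A) xs φ → ∑split (x ∷ xs) φ ≡ ∑split xs (place x φ)
∑split-∷ x xs φ = begin
  ∑split (x ∷ xs) φ
    ≡⟨ ∑-++ (map (map₂ (x ∷_)) (splits xs)) _ (uncurry φ) ⟩
  ∑ (map (map₂ (x ∷_)) (splits xs)) (uncurry φ) + ∑ (map (map₁ (x ∷_)) (splits xs)) (uncurry φ)
    ≡⟨ cong₂ _+_ (∑-map (map₂ (x ∷_)) (splits xs) (uncurry φ))
                 (∑-map (map₁ (x ∷_)) (splits xs) (uncurry φ)) ⟩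
  ∑split xs (λ S R → φ S (x ∷ R)) + ∑split xs (λ S R → φ (x ∷ S) R)
    ≡⟨ ∑-+ (splits xs) _ _ ⟨
  ∑split xs (place x φ) ∎
  where open ≡-Reasoning

splits-↭ : ∀ (xs : List A) → All (λ (S , R) → S ++ R ↭ xs) (splits xs)
splits-↭ []       = ↭.refl ∷ []
splits-↭ (x ∷ xs) = All.++⁺
  (All.map⁺ (All.map (λ {(S , R)} p → ↭.trans (shift x S R) (↭.prep x p)) (splits-↭ xs)))
  (All.map⁺ (All.map (↭.prep x) (splits-↭ xs)))

↭-++-length≤ʳ : ∀ (S : List A) {R X} → S ++ R ↭ X → length R ≤ length X
↭-++-length≤ʳ S {R} p =
  subst (length R ≤_) (trans (sym (length-++ S)) (↭-length p)) (m≤n+m (length R) (length S))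

-- The bound on the length of R is what lets F-↭ below be proved by induction on length.
RespectsSplit : (List A → List A → ℤ) → ℕ → Set
RespectsSplit φ k = ∀ {S S′ R R′} → S ↭ S′ → R ↭ R′ → length R ≤ k → φ S R ≡ φ S′ R′

place-respects : ∀ (x : A) {φ k} → RespectsSplit φ (suc k) → RespectsSplit (place x φ) k
place-respects x resp s r le =
  cong₂ _+_ (resp s (↭.prep x r) (s≤s le)) (resp (↭.prep x s) r (m≤n⇒m≤1+n le))

∑split-↭ : ∀ {xs ys : List A} → xs ↭ ys → ∀ φ → RespectsSplit φ (length xs) →
  ∑split xs φ ≡ ∑split ys φ
∑split-↭ ↭.refl φ resp = refl
∑split-↭ {xs = x ∷ xs} {x ∷ ys} (↭.prep x p) φ resp = begin
  ∑split (x ∷ xs) φ         ≡⟨ ∑split-∷ x xs φ ⟩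
  ∑split xs (place x φ)     ≡⟨ ∑split-↭ p (place x φ) (place-respects x resp) ⟩
  ∑split ys (place x φ)     ≡⟨ ∑split-∷ x ys φ ⟨
  ∑split (x ∷ ys) φ         ∎
  where open ≡-Reasoning
∑split-↭ {xs = x ∷ y ∷ xs} {y ∷ x ∷ ys} (↭.swap x y p) φ resp = begin
  ∑split (x ∷ y ∷ xs) φ            ≡⟨ trans (∑split-∷ x (y ∷ xs) φ) (∑split-∷ y xs (place x φ)) ⟩
  ∑split xs (place y (place x φ))  ≡⟨ ∑split-↭ p _ (place-respects y (place-respects x resp)) ⟩
  ∑split ys (place y (place x φ))
    ≡⟨ ∑-congᴬ (All.map (λ {(S , R)} p → swapped S R (↭-++-length≤ʳ S p)) (splits-↭ ys)) ⟩
  ∑split ys (place x (place y φ))  ≡⟨ trans (∑split-∷ y (x ∷ ys) φ) (∑split-∷ x ys (place y φ)) ⟨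
  ∑split (y ∷ x ∷ ys) φ            ∎
  where
  open ≡-Reasoning
  swapped : ∀ S R → length R ≤ length ys →
    place y (place x φ) S R ≡ place x (place y φ) S R
  swapped S R le = trans
    (+-interchange (φ S (x ∷ y ∷ R)) (φ (x ∷ S) (y ∷ R)) (φ (y ∷ S) (x ∷ R)) (φ (x ∷ y ∷ S) R))
    (cong₂ _+_ (cong (_+ φ (y ∷ S) (x ∷ R)) (resp ↭.refl (↭.swap x y ↭.refl) (s≤s (s≤s le′))))
               (cong (φ (x ∷ S) (y ∷ R) +_)
                     (resp (↭.swap x y ↭.refl) ↭.refl (m≤n⇒m≤1+n (m≤n⇒m≤1+n le′)))))
    where
    le′ : length R ≤ length xs
    le′ = subst (length R ≤_) (sym (↭-length p)) le
∑split-↭ (↭.trans p q) φ resp =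
  trans (∑split-↭ p φ resp) (∑split-↭ q φ (λ s r le → resp s r (subst (_ ≤_) (sym (↭-length p)) le)))

∑split-++ : ∀ (X C : List A) φ →
  ∑split (X ++ C) φ ≡ ∑split X (λ S R → ∑split C (λ S′ R′ → φ (S ++ S′) (R ++ R′)))
∑split-++ []      C φ = sym (+-identityʳ _)
∑split-++ (x ∷ X) C φ = begin
  ∑split (x ∷ X ++ C) φ
    ≡⟨ ∑split-∷ x (X ++ C) φ ⟩
  ∑split (X ++ C) (place x φ)
    ≡⟨ ∑split-++ X C (place x φ) ⟩
  ∑split X (λ S R → ∑split C (λ S′ R′ → place x φ (S ++ S′) (R ++ R′)))
    ≡⟨ ∑-cong (splits X) (λ (S , R) → ∑-+ (splits C) _ _) ⟩
  ∑split X (place x (λ S R → ∑split C (λ S′ R′ → φ (S ++ S′) (R ++ R′))))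
    ≡⟨ ∑split-∷ x X _ ⟨
  ∑split (x ∷ X) (λ S R → ∑split C (λ S′ R′ → φ (S ++ S′) (R ++ R′))) ∎
  where open ≡-Reasoning

∑split-nothing-chosen : ∀ (xs : List A) φ → (∀ {y S R} → y ∈ S → y ∈ xs → φ S R ≡ 0ℤ) →
  ∑split xs φ ≡ φ [] xs
∑split-nothing-chosen []       φ vanish = +-identityʳ _
∑split-nothing-chosen (x ∷ xs) φ vanish = begin
  ∑split (x ∷ xs) φ                   ≡⟨ ∑split-∷ x xs φ ⟩
  ∑split xs (place x φ)               ≡⟨ ∑split-nothing-chosen xs (place x φ) vanish′ ⟩
  φ [] (x ∷ xs) + φ (x ∷ []) xs       ≡⟨ cong (φ [] (x ∷ xs) +_) (vanish (here refl) (here refl)) ⟩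
  φ [] (x ∷ xs) + 0ℤ                  ≡⟨ +-identityʳ _ ⟩
  φ [] (x ∷ xs)                       ∎
  where
  open ≡-Reasoning
  vanish′ : ∀ {y S R} → y ∈ S → y ∈ xs → place x φ S R ≡ 0ℤ
  vanish′ yS yxs = cong₂ _+_ (vanish yS (there yxs)) (vanish (here refl) (here refl))

∑split² : List A → (List A → List A → List A → ℤ) → ℤ
∑split² L f = ∑split L (λ S R → ∑split R (f S))

∑split²-∷ : ∀ (z : A) L f → ∑split² (z ∷ L) f ≡
  ∑split² L (λ S S′ R′ → f S S′ (z ∷ R′)) + ∑split² L (λ S S′ R′ → f S (z ∷ S′) R′)
    + ∑split² L (λ S → f (z ∷ S))
∑split²-∷ z L f = begin
  ∑split² (z ∷ L) f
    ≡⟨ ∑split-∷ z L _ ⟩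
  ∑split L (λ S R → ∑split (z ∷ R) (f S) + ∑split R (f (z ∷ S)))
    ≡⟨ ∑-cong (splits L) (λ (S , R) → cong (_+ ∑split R (f (z ∷ S)))
         (trans (∑split-∷ z R (f S)) (∑-+ (splits R) _ _))) ⟩
  ∑split L (λ S R → ∑split R (λ S′ R′ → f S S′ (z ∷ R′)) + ∑split R (λ S′ R′ → f S (z ∷ S′) R′)
                      + ∑split R (f (z ∷ S)))
    ≡⟨ trans (∑-+ (splits L) _ _) (cong (_+ ∑split² L (λ S → f (z ∷ S))) (∑-+ (splits L) _ _)) ⟩
  ∑split² L (λ S S′ R′ → f S S′ (z ∷ R′)) + ∑split² L (λ S S′ R′ → f S (z ∷ S′) R′)
    + ∑split² L (λ S → f (z ∷ S)) ∎
  where open ≡-Reasoning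

∑split²-comm : ∀ (L : List A) f → ∑split² L f ≡ ∑split² L (λ S S′ → f S′ S)
∑split²-comm []      f = refl
∑split²-comm (z ∷ L) f = begin
  ∑split² (z ∷ L) f
    ≡⟨ ∑split²-∷ z L f ⟩
  ∑split² L (λ S S′ R′ → f S S′ (z ∷ R′)) + ∑split² L (λ S S′ → f S (z ∷ S′))
    + ∑split² L (λ S → f (z ∷ S))
    ≡⟨ cong₂ _+_ (cong₂ _+_ (∑split²-comm L _) (∑split²-comm L _)) (∑split²-comm L _) ⟩
  ∑split² L (λ S S′ R′ → f S′ S (z ∷ R′)) + ∑split² L (λ S S′ → f S′ (z ∷ S))
    + ∑split² L (λ S S′ → f (z ∷ S′) S)
    ≡⟨ +-swapʳ (∑split² L (λ S S′ R′ → f S′ S (z ∷ R′))) _ _ ⟩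
  ∑split² L (λ S S′ R′ → f S′ S (z ∷ R′)) + ∑split² L (λ S S′ → f (z ∷ S′) S)
    + ∑split² L (λ S S′ → f S′ (z ∷ S))
    ≡⟨ ∑split²-∷ z L (λ S S′ → f S′ S) ⟨
  ∑split² (z ∷ L) (λ S S′ → f S′ S) ∎
  where open ≡-Reasoning

picks : List (List A) → List (List A × List (List A))
picks []      = []
picks (b ∷ P) = (b , P) ∷ map (map₂ (b ∷_)) (picks P)

∑picks : List (List A) → (List A → List (List A) → ℤ) → ℤ
∑picks P h = ∑ (picks P) (uncurry h)

∑picks-∷ : ∀ (b : List A) P h → ∑picks (b ∷ P) h ≡ h b P + ∑picks P (λ b′ Q → h b′ (b ∷ Q))
∑picks-∷ b P h = cong (h b P +_) (∑-map (map₂ (b ∷_)) (picks P) (uncurry h))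

∑-addToSomeBlock-∷ : ∀ (y : A) b P f →
  ∑ (addToSomeBlock y (b ∷ P)) f ≡ f ((y ∷ b) ∷ P) + ∑ (addToSomeBlock y P) (f ∘ (b ∷_))
∑-addToSomeBlock-∷ y b P f = cong (f ((y ∷ b) ∷ P) +_) (∑-map (b ∷_) (addToSomeBlock y P) f)

∑picks-addToSomeBlock : ∀ (y : A) P h →
  ∑ (addToSomeBlock y P) (λ P′ → ∑picks P′ h)
    ≡ ∑picks P (λ b Q → h (y ∷ b) Q) + ∑picks P (λ b Q → ∑ (addToSomeBlock y Q) (h b))
∑picks-addToSomeBlock y []      h = refl
∑picks-addToSomeBlock {A} y (b ∷ P) h = begin
  ∑ (addToSomeBlock y (b ∷ P)) (λ P′ → ∑picks P′ h)
    ≡⟨ ∑-addToSomeBlock-∷ y b P (λ P′ → ∑picks P′ h) ⟩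
  ∑picks ((y ∷ b) ∷ P) h + ∑ (addToSomeBlock y P) (λ P′ → ∑picks (b ∷ P′) h)
    ≡⟨ cong₂ _+_ (∑picks-∷ (y ∷ b) P h)
                 (trans (∑-cong (addToSomeBlock y P) (λ P′ → ∑picks-∷ b P′ h))
                        (∑-+ (addToSomeBlock y P) (h b) _)) ⟩
  h (y ∷ b) P + q + (r + ∑ (addToSomeBlock y P) (λ P′ → ∑picks P′ h′))
    ≡⟨ cong (λ z → h (y ∷ b) P + q + (r + z)) (∑picks-addToSomeBlock y P h′) ⟩
  h (y ∷ b) P + q + (r + (s + t))
    ≡⟨ regroup (h (y ∷ b) P) q r s t ⟩
  h (y ∷ b) P + s + (r + (q + t))
    ≡⟨ cong₂ _+_ (∑picks-∷ b P (λ b′ Q → h (y ∷ b′) Q))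
         (trans (∑picks-∷ b P (λ b′ Q → ∑ (addToSomeBlock y Q) (h b′)))
                (cong (r +_) (trans (∑-cong (picks P) (λ (b′ , Q) → ∑-addToSomeBlock-∷ y b Q (h b′)))
                                    (∑-+ (picks P) _ _)))) ⟨
  ∑picks (b ∷ P) (λ b′ Q → h (y ∷ b′) Q) + ∑picks (b ∷ P) (λ b′ Q → ∑ (addToSomeBlock y Q) (h b′)) ∎
  where
  open ≡-Reasoning
  h′ : List A → List (List A) → ℤ
  h′ b′ Q = h b′ (b ∷ Q)
  q r s t : ℤ
  q = ∑picks P (λ b′ Q → h b′ ((y ∷ b) ∷ Q))
  r = ∑ (addToSomeBlock y P) (h b)
  s = ∑picks P (λ b′ Q → h′ (y ∷ b′) Q)
  t = ∑picks P (λ b′ Q → ∑ (addToSomeBlock y Q) (h′ b′))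
  regroup : ∀ a b c d e → a + b + (c + (d + e)) ≡ a + d + (c + (b + e))
  regroup = solve-∀

-- h b Q: a new element joins the block b of P, the other blocks being Q; b = [] opens a new block.
∑marked : List (List A) → (List A → List (List A) → ℤ) → ℤ
∑marked P h = h [] P + ∑picks P h

∑insertions : A → (List (List A) → ℤ) → List (List A) → ℤ
∑insertions y f P = f ((y ∷ []) ∷ P) + ∑ (addToSomeBlock y P) f

∑-setPartitions-∷ : ∀ (y : A) ys f →
  ∑ (setPartitions (y ∷ ys)) f ≡ ∑ (setPartitions ys) (∑insertions y f)
∑-setPartitions-∷ y ys f = ∑-concatMap _ (setPartitions ys) f

∑marked-insertions : ∀ (y : A) P (k : List A → ℤ) (Φ : List (List A) → ℤ) →
  ∑insertions y (λ P′ → ∑marked P′ (λ b Q → k b * Φ Q)) P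
    ≡ ∑marked P (λ b Q → k b * ∑insertions y Φ Q) + ∑marked P (λ b Q → k (y ∷ b) * Φ Q)
∑marked-insertions y P k Φ = begin
  ∑insertions y (λ P′ → ∑marked P′ (λ b Q → k b * Φ Q)) P
    ≡⟨ cong₂ _+_ (cong (a +_) (∑picks-∷ (y ∷ []) P (λ b Q → k b * Φ Q)))
         (trans (∑-+ (addToSomeBlock y P) _ _)
           (cong₂ _+_ (∑-*ˡ (addToSomeBlock y P) Φ (k []))
             (trans (∑picks-addToSomeBlock y P (λ b Q → k b * Φ Q))
               (cong (d +_) (∑-cong (picks P) (λ (b , Q) → ∑-*ˡ (addToSomeBlock y Q) Φ (k b))))))) ⟩
  a + (p + q) + (c + (d + e))
    ≡⟨ regroup a p q c d e ⟩
  a + c + (q + e) + (p + d)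
    ≡⟨ cong (_+ (p + d)) (cong₂ _+_ (*-distribˡ-+ (k []) _ _)
         (trans (∑-cong (picks P) (λ (b , Q) → *-distribˡ-+ (k b) _ _)) (∑-+ (picks P) _ _))) ⟨
  ∑marked P (λ b Q → k b * ∑insertions y Φ Q) + ∑marked P (λ b Q → k (y ∷ b) * Φ Q) ∎
  where
  open ≡-Reasoning
  a p q c d e : ℤ
  a = k [] * Φ ((y ∷ []) ∷ P)
  p = k (y ∷ []) * Φ P
  q = ∑picks P (λ b Q → k b * Φ ((y ∷ []) ∷ Q))
  c = k [] * ∑ (addToSomeBlock y P) Φ
  d = ∑picks P (λ b Q → k (y ∷ b) * Φ Q)
  e = ∑picks P (λ b Q → k b * ∑ (addToSomeBlock y Q) Φ)
  regroup : ∀ a p q c d e → a + (p + q) + (c + (d + e)) ≡ a + c + (q + e) + (p + d)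
  regroup = solve-∀

∑-markedPartitions : ∀ (xs : List A) (k : List A → ℤ) (Φ : List (List A) → ℤ) →
  ∑ (setPartitions xs) (λ P → ∑marked P (λ b Q → k b * Φ Q))
    ≡ ∑split xs (λ S R → k S * ∑ (setPartitions R) Φ)
∑-markedPartitions []       k Φ =
  cong (_+ 0ℤ) (trans (+-identityʳ _) (cong (k [] *_) (sym (+-identityʳ _))))
∑-markedPartitions (y ∷ ys) k Φ = begin
  ∑ (setPartitions (y ∷ ys)) (λ P → ∑marked P (λ b Q → k b * Φ Q))
    ≡⟨ ∑-setPartitions-∷ y ys (λ P → ∑marked P (λ b Q → k b * Φ Q)) ⟩
  ∑ (setPartitions ys) (∑insertions y (λ P′ → ∑marked P′ (λ b Q → k b * Φ Q)))
    ≡⟨ trans (∑-cong (setPartitions ys) (λ P → ∑marked-insertions y P k Φ))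
             (∑-+ (setPartitions ys) _ _) ⟩
  ∑ (setPartitions ys) (λ P → ∑marked P (λ b Q → k b * ∑insertions y Φ Q))
    + ∑ (setPartitions ys) (λ P → ∑marked P (λ b Q → k (y ∷ b) * Φ Q))
    ≡⟨ cong₂ _+_ (∑-markedPartitions ys k (∑insertions y Φ)) (∑-markedPartitions ys (k ∘ (y ∷_)) Φ) ⟩
  ∑split ys (λ S R → k S * ∑ (setPartitions R) (∑insertions y Φ))
    + ∑split ys (λ S R → k (y ∷ S) * ∑ (setPartitions R) Φ)
    ≡⟨ cong (_+ ∑split ys (λ S R → k (y ∷ S) * ∑ (setPartitions R) Φ))
         (∑-cong (splits ys) (λ (S , R) → cong (k S *_) (∑-setPartitions-∷ y R Φ))) ⟨
  ∑split ys (λ S R → k S * ∑ (setPartitions (y ∷ R)) Φ)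
    + ∑split ys (λ S R → k (y ∷ S) * ∑ (setPartitions R) Φ)
    ≡⟨ trans (∑split-∷ y ys (λ S R → k S * ∑ (setPartitions R) Φ)) (∑-+ (splits ys) _ _) ⟨
  ∑split (y ∷ ys) (λ S R → k S * ∑ (setPartitions R) Φ) ∎
  where open ≡-Reasoning

module WeightedPartitions {A : Set} (g : List A → ℤ) where

  W : List (List A) → ℤ
  W P = productℤ (map g P)

  F : List A → ℤ
  F V = ∑ (setPartitions V) W

  headedBy : A → List A → List A → ℤ
  headedBy x S R = g (x ∷ S) * F R

  ∑-addToSomeBlock-W : ∀ x P → ∑ (addToSomeBlock x P) W ≡ ∑picks P (λ b Q → g (x ∷ b) * W Q)
  ∑-addToSomeBlock-W x []      = refl
  ∑-addToSomeBlock-W x (b ∷ P) = begin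
    ∑ (addToSomeBlock x (b ∷ P)) W
      ≡⟨ ∑-addToSomeBlock-∷ x b P W ⟩
    g (x ∷ b) * W P + ∑ (addToSomeBlock x P) (λ Q → g b * W Q)
      ≡⟨ cong (g (x ∷ b) * W P +_) (trans (∑-*ˡ (addToSomeBlock x P) W (g b))
                                          (cong (g b *_) (∑-addToSomeBlock-W x P))) ⟩
    g (x ∷ b) * W P + g b * ∑picks P (λ b′ Q → g (x ∷ b′) * W Q)
      ≡⟨ cong (g (x ∷ b) * W P +_)
           (trans (∑-cong (picks P) (λ (b′ , Q) → *-exchange (g (x ∷ b′)) (g b) (W Q)))
                  (∑-*ˡ (picks P) _ (g b))) ⟨
    g (x ∷ b) * W P + ∑picks P (λ b′ Q → g (x ∷ b′) * W (b ∷ Q))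
      ≡⟨ ∑picks-∷ b P (λ b′ Q → g (x ∷ b′) * W Q) ⟨
    ∑picks (b ∷ P) (λ b′ Q → g (x ∷ b′) * W Q) ∎
    where open ≡-Reasoning

  F-∷ : ∀ x xs → F (x ∷ xs) ≡ ∑split xs (headedBy x)
  F-∷ x xs = begin
    F (x ∷ xs)
      ≡⟨ ∑-setPartitions-∷ x xs W ⟩
    ∑ (setPartitions xs) (∑insertions x W)
      ≡⟨ ∑-cong (setPartitions xs) (λ P → cong (W ((x ∷ []) ∷ P) +_) (∑-addToSomeBlock-W x P)) ⟩
    ∑ (setPartitions xs) (λ P → ∑marked P (λ b Q → g (x ∷ b) * W Q))
      ≡⟨ ∑-markedPartitions xs (g ∘ (x ∷_)) W ⟩
    ∑split xs (headedBy x) ∎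
    where open ≡-Reasoning

  F-∷-∷ : ∀ x y zs → F (x ∷ y ∷ zs) ≡ ∑split zs (place y (headedBy x))
  F-∷-∷ x y zs = trans (F-∷ x (y ∷ zs)) (∑split-∷ y zs (headedBy x))

  ∑split-headedBy-comm : ∀ x y zs →
    ∑split zs (λ S R → g (x ∷ S) * F (y ∷ R)) ≡ ∑split zs (λ S R → g (y ∷ S) * F (x ∷ R))
  ∑split-headedBy-comm x y zs = begin
    ∑split zs (λ S R → g (x ∷ S) * F (y ∷ R))
      ≡⟨ expand x y ⟩
    ∑split² zs (λ S S′ R′ → g (x ∷ S) * (g (y ∷ S′) * F R′))
      ≡⟨ ∑split²-comm zs _ ⟩
    ∑split² zs (λ S S′ R′ → g (x ∷ S′) * (g (y ∷ S) * F R′))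
      ≡⟨ ∑-cong (splits zs) (λ (S , R) → ∑-cong (splits R) (λ (S′ , R′) →
           *-exchange (g (x ∷ S′)) (g (y ∷ S)) (F R′))) ⟩
    ∑split² zs (λ S S′ R′ → g (y ∷ S) * (g (x ∷ S′) * F R′))
      ≡⟨ expand y x ⟨
    ∑split zs (λ S R → g (y ∷ S) * F (x ∷ R)) ∎
    where
    open ≡-Reasoning
    expand : ∀ a b → ∑split zs (λ S R → g (a ∷ S) * F (b ∷ R))
                   ≡ ∑split² zs (λ S S′ R′ → g (a ∷ S) * (g (b ∷ S′) * F R′))
    expand a b = ∑-cong (splits zs) (λ (S , R) →
      trans (cong (g (a ∷ S) *_) (F-∷ b R)) (sym (∑-*ˡ (splits R) _ (g (a ∷ S)))))

  module _ (g-↭ : ∀ {b b′} → b ↭ b′ → g b ≡ g b′) where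

    private
      Invariant≤ : ℕ → Set
      Invariant≤ k = ∀ {V V′} → length V ≤ k → V ↭ V′ → F V ≡ F V′

      headedBy-respects : ∀ {k} → Invariant≤ k → ∀ x {l} → l ≤ k → RespectsSplit (headedBy x) l
      headedBy-respects ih x l≤k S↭ R↭ lR = cong₂ _*_ (g-↭ (↭.prep x S↭)) (ih (≤-trans lR l≤k) R↭)

      invariant-step : ∀ {k} → Invariant≤ k → Invariant≤ (suc k)
      invariant-step ih le ↭.refl        = refl
      invariant-step ih le (↭.trans p q) =
        trans (invariant-step ih le p) (invariant-step ih (subst (_≤ _) (↭-length p) le) q)
      invariant-step ih (s≤s le) (↭.prep {xs = xs} {ys = ys} x p) = begin
        F (x ∷ xs)              ≡⟨ F-∷ x xs ⟩
        ∑split xs (headedBy x)  ≡⟨ ∑split-↭ p (headedBy x) (headedBy-respects ih x le) ⟩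
        ∑split ys (headedBy x)  ≡⟨ F-∷ x ys ⟨
        F (x ∷ ys)              ∎
        where open ≡-Reasoning
      invariant-step ih (s≤s le) (↭.swap {xs = xs} {ys = ys} x y p) = begin
        F (x ∷ y ∷ xs)
          ≡⟨ F-∷-∷ x y xs ⟩
        ∑split xs (place y (headedBy x))
          ≡⟨ ∑split-↭ p _ (place-respects y (headedBy-respects ih x le)) ⟩
        ∑split ys (place y (headedBy x))
          ≡⟨ ∑-+ (splits ys) _ _ ⟩
        ∑split ys (λ S R → g (x ∷ S) * F (y ∷ R)) + ∑split ys (λ S R → g (x ∷ y ∷ S) * F R)
          ≡⟨ cong₂ _+_ (∑split-headedBy-comm x y ys)
               (∑-cong (splits ys) (λ (S , R) → cong (_* F R) (g-↭ (↭.swap x y ↭.refl)))) ⟩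
        ∑split ys (λ S R → g (y ∷ S) * F (x ∷ R)) + ∑split ys (λ S R → g (y ∷ x ∷ S) * F R)
          ≡⟨ ∑-+ (splits ys) _ _ ⟨
        ∑split ys (place x (headedBy y))
          ≡⟨ F-∷-∷ y x ys ⟨
        F (y ∷ x ∷ ys) ∎
        where open ≡-Reasoning

      invariant : ∀ k → Invariant≤ k
      invariant zero    {[]} _ p with refl ← ↭-empty-inv (↭.↭-sym p) = refl
      invariant (suc k) = invariant-step (invariant k)

    F-↭ : ∀ {V V′} → V ↭ V′ → F V ≡ F V′
    F-↭ = invariant _ ≤-refl

  Separated : List A → List A → Set
  Separated X C = ∀ b {a c} → a ∈ X → c ∈ C → a ∈ b → c ∈ b → g b ≡ 0ℤ

  private
    F-++≤ : ∀ k X C → length X ≤ k → Separated X C → F (X ++ C) ≡ F X * F C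
    F-++≤ k       []      C _        _   = sym (*-identityˡ (F C))
    F-++≤ (suc k) (x ∷ X) C (s≤s le) sep = begin
      F (x ∷ X ++ C)
        ≡⟨ F-∷ x (X ++ C) ⟩
      ∑split (X ++ C) (headedBy x)
        ≡⟨ ∑split-++ X C (headedBy x) ⟩
      ∑split X (λ S R → ∑split C (λ S′ R′ → g (x ∷ S ++ S′) * F (R ++ R′)))
        ≡⟨ ∑-congᴬ (All.map (λ {(S , R)} → splitting-X S R) (splits-↭ X)) ⟩
      ∑split X (λ S R → headedBy x S R * F C)
        ≡⟨ ∑-*ʳ (splits X) _ (F C) ⟩
      ∑split X (headedBy x) * F C
        ≡⟨ cong (_* F C) (F-∷ x X) ⟨
      F (x ∷ X) * F C ∎
      where
      open ≡-Reasoning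
      splitting-X : ∀ S R → S ++ R ↭ X →
        ∑split C (λ S′ R′ → g (x ∷ S ++ S′) * F (R ++ R′)) ≡ headedBy x S R * F C
      splitting-X S R p = begin
        ∑split C (λ S′ R′ → g (x ∷ S ++ S′) * F (R ++ R′))
          -- a block containing x and an element of C has weight 0
          ≡⟨ ∑split-nothing-chosen C _ (λ {_} {S′} {R′} y∈S′ y∈C →
               trans (cong (_* F (R ++ R′))
                           (sep (x ∷ S ++ S′) (here refl) y∈C (here refl) (there (∈-++⁺ʳ S y∈S′))))
                     (*-zeroˡ (F (R ++ R′)))) ⟩
        g (x ∷ S ++ []) * F (R ++ C)
          ≡⟨ cong₂ _*_ (cong (g ∘ (x ∷_)) (++-identityʳ S))
                       (F-++≤ k R C (≤-trans (↭-++-length≤ʳ S p) le)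
                         (λ b a∈R → sep b (there (∈-resp-↭ p (∈-++⁺ʳ S a∈R))))) ⟩
        g (x ∷ S) * (F R * F C)
          ≡⟨ *-assoc (g (x ∷ S)) (F R) (F C) ⟨
        headedBy x S R * F C ∎

  F-++ : ∀ X C → Separated X C → F (X ++ C) ≡ F X * F C
  F-++ X C = F-++≤ (length X) X C ≤-refl

  Clustered : List (List A) → Set
  Clustered Cs = ∀ b {a c} → a ∈ b → c ∈ b → a ∈ concat Cs → c ∈ concat Cs →
    g b ≡ 0ℤ ⊎ Any (λ C → a ∈ C × c ∈ C) Cs

  F-concat : ∀ Cs → Unique (concat Cs) → Clustered Cs → F (concat Cs) ≡ productℤ (map F Cs)
  F-concat []       _ _  = refl
  F-concat (C ∷ Cs) u cl =
    trans (F-++ C (concat Cs) separated) (cong (F C *_) (F-concat Cs (Unique-++⁻ʳ C u) clustered))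
    where
    disjoint : ∀ {a} → a ∈ C → a ∈ concat Cs → ⊥
    disjoint = Unique-++⇒disjoint C u
    separated : Separated C (concat Cs)
    separated b a∈C c∈Cs a∈b c∈b with cl b a∈b c∈b (∈-++⁺ˡ a∈C) (∈-++⁺ʳ C c∈Cs)
    ... | inj₁ vanishes             = vanishes
    ... | inj₂ (here (_ , c∈C))     = ⊥-elim (disjoint c∈C c∈Cs)
    ... | inj₂ (there a,c∈some)     = ⊥-elim (disjoint a∈C (∈-concat⁺ (Any.map proj₁ a,c∈some)))
    clustered : Clustered Cs
    clustered b a∈b c∈b a∈Cs c∈Cs with cl b a∈b c∈b (∈-++⁺ʳ C a∈Cs) (∈-++⁺ʳ C c∈Cs)
    ... | inj₁ vanishes         = inj₁ vanishes
    ... | inj₂ (here (a∈C , _)) = ⊥-elim (disjoint a∈C a∈Cs)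
    ... | inj₂ (there a,c∈some) = inj₂ a,c∈some

signedWeight : (List A → Bool) → List A → ℤ
signedWeight ok b = if ok b then -1ℤ ^ (length b ∸ 1) else 0ℤ

∑-filterᵇ : ∀ (p : A → Bool) xs f → ∑ (filterᵇ p xs) f ≡ ∑ xs (λ x → if p x then f x else 0ℤ)
∑-filterᵇ p []       f = refl
∑-filterᵇ p (x ∷ xs) f with p x
... | true  = cong (f x +_) (∑-filterᵇ p xs f)
... | false = trans (∑-filterᵇ p xs f) (sym (+-identityˡ _))

NonEmptyBlocks : List (List A) → Set
NonEmptyBlocks P = All (λ b → 0 < length b) P

PartitionOfSize : ℕ → List (List A) → Set
PartitionOfSize n P = NonEmptyBlocks P × sum (map length P) ≡ n

addToSomeBlock-partition : ∀ (x : A) P → NonEmptyBlocks P →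
  All (PartitionOfSize (suc (sum (map length P)))) (addToSomeBlock x P)
addToSomeBlock-partition x []      _           = []
addToSomeBlock-partition x (b ∷ P) (b≠[] ∷ ne) =
  (s≤s z≤n ∷ ne , refl) ∷ All.map⁺ (All.map (λ (ne′ , size) →
    b≠[] ∷ ne′ , trans (cong (length b ℕ.+_) size) (+-suc (length b) _))
    (addToSomeBlock-partition x P ne))

setPartitions-partition : ∀ (V : List A) → All (PartitionOfSize (length V)) (setPartitions V)
setPartitions-partition []      = ([] , refl) ∷ []
setPartitions-partition (x ∷ V) = All.concat⁺ (All.map⁺ (All.map (λ {P} (ne , size) →
    (s≤s z≤n ∷ ne , cong suc size)
  ∷ subst (λ n → All (PartitionOfSize (suc n)) (addToSomeBlock x P)) size
          (addToSomeBlock-partition x P ne))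
  (setPartitions-partition V)))

length≤sum-length : ∀ (P : List (List A)) → NonEmptyBlocks P → length P ≤ sum (map length P)
length≤sum-length []      []          = z≤n
length≤sum-length (b ∷ P) (b≠[] ∷ ne) = +-mono-≤ b≠[] (length≤sum-length P ne)

-- For nonempty blocks, Σ_b |b| - |P| = Σ_b (|b| - 1).
signedWeight-product : ∀ (ok : List A → Bool) P → NonEmptyBlocks P →
  (if all ok P then -1ℤ ^ (sum (map length P) ∸ length P) else 0ℤ)
    ≡ productℤ (map (signedWeight ok) P)
signedWeight-product ok []      []          = refl
signedWeight-product ok (b ∷ P) (b≠[] ∷ ne) with ok b
... | false = sym (*-zeroˡ (productℤ (map (signedWeight ok) P)))
... | true with all ok P | signedWeight-product ok P ne
...   | false | ih = trans (sym (*-zeroʳ (-1ℤ ^ (length b ∸ 1)))) (cong (-1ℤ ^ (length b ∸ 1) *_) ih)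
...   | true  | ih = begin
  -1ℤ ^ ((length b ℕ.+ sum (map length P)) ∸ suc (length P))
    ≡⟨ cong (-1ℤ ^_) (exponent (length b) b≠[]) ⟩
  -1ℤ ^ ((length b ∸ 1) ℕ.+ (sum (map length P) ∸ length P))
    ≡⟨ ^-distribˡ-+-* -1ℤ (length b ∸ 1) _ ⟩
  -1ℤ ^ (length b ∸ 1) * -1ℤ ^ (sum (map length P) ∸ length P)
    ≡⟨ cong (-1ℤ ^ (length b ∸ 1) *_) ih ⟩
  -1ℤ ^ (length b ∸ 1) * productℤ (map (signedWeight ok) P) ∎
  where
  open ≡-Reasoning
  exponent : ∀ l → 0 < l →
    (l ℕ.+ sum (map length P)) ∸ suc (length P) ≡ (l ∸ 1) ℕ.+ (sum (map length P) ∸ length P)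
  exponent (suc l) _ = +-∸-assoc l (length≤sum-length P ne)

∑-signedBoxings : ∀ (ok : List A → Bool) V →
  ∑ (filterᵇ (all ok) (setPartitions V)) (λ P → -1ℤ ^ (length V ∸ length P))
    ≡ WeightedPartitions.F (signedWeight ok) V
∑-signedBoxings ok V = trans (∑-filterᵇ (all ok) (setPartitions V) _)
  (∑-congᴬ (All.map (λ {P} (ne , size) →
     trans (cong (λ n → if all ok P then -1ℤ ^ (n ∸ length P) else 0ℤ) (sym size))
           (signedWeight-product ok P ne))
   (setPartitions-partition V)))

signedWeight-↭ : ∀ (ok : List A → Bool) → (∀ {b b′} → b ↭ b′ → ok b ≡ ok b′) →
  ∀ {b b′} → b ↭ b′ → signedWeight ok b ≡ signedWeight ok b′
signedWeight-↭ ok ok-↭ p = cong₂ (λ o k → if o then -1ℤ ^ (k ∸ 1) else 0ℤ) (ok-↭ p) (↭-length p)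

∈-insertions⁻ : ∀ (x : A) ys {L} → L ∈ insertions x ys → L ↭ x ∷ ys
∈-insertions⁻ x []       (here refl) = ↭.refl
∈-insertions⁻ x (y ∷ ys) (here refl) = ↭.refl
∈-insertions⁻ x (y ∷ ys) (there L∈) with L′ , L′∈ , refl ← ∈-map⁻ (y ∷_) L∈ =
  ↭.trans (↭.prep y (∈-insertions⁻ x ys L′∈)) (↭.swap y x ↭.refl)

∈-insertions⁺ : ∀ (x : A) ys zs → ys ++ x ∷ zs ∈ insertions x (ys ++ zs)
∈-insertions⁺ x []       []       = here refl
∈-insertions⁺ x []       (z ∷ zs) = here refl
∈-insertions⁺ x (y ∷ ys) zs       = there (∈-map⁺ (y ∷_) (∈-insertions⁺ x ys zs))

∈-perms⁻ : ∀ (b : List A) {L} → L ∈ perms b → L ↭ b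
∈-perms⁻ []       (here refl) = ↭.refl
∈-perms⁻ (x ∷ xs) L∈
  with M , L∈M , M∈ ← ∈-concat⁻′ (map (insertions x) (perms xs)) L∈
  with M′ , M′∈ , refl ← ∈-map⁻ (insertions x) M∈
  = ↭.trans (∈-insertions⁻ x M′ L∈M) (↭.prep x (∈-perms⁻ xs M′∈))

∈-perms⁺ : ∀ (b : List A) {L} → L ↭ b → L ∈ perms b
∈-perms⁺ []       L↭[] with refl ← ↭-empty-inv L↭[] = here refl
∈-perms⁺ (x ∷ xs) L↭b
  with ys , zs , refl ← ∈-∃++ (∈-resp-↭ (↭.↭-sym L↭b) (here refl))
  = ∈-concat⁺′ (∈-insertions⁺ x ys zs) (∈-map⁺ (insertions x) (∈-perms⁺ xs (drop-mid ys [] L↭b)))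

any-perms-↭ : ∀ (p : List A → Bool) {b b′} → b ↭ b′ → any p (perms b) ≡ any p (perms b′)
any-perms-↭ p b↭b′ = T⇔T⇒≡ (mk⇔ (transport b↭b′) (transport (↭.↭-sym b↭b′)))
  where
  transport : ∀ {b b′} → b ↭ b′ → T (any p (perms b)) → T (any p (perms b′))
  transport {b} {b′} b↭b′ t with L , L∈ , pL ← find (any⁻ p (perms b) t) =
    any⁺ p (lose (∈-perms⁺ b′ (↭.trans (∈-perms⁻ b L∈) b↭b′)) pL)

Link : ℕ → Set
Link n = Fin n × Fin n × ℕ

-- (h , (v₁ , l₁) ∷ (v₂ , l₂) ∷ …) is the cadet sequence h, v₁, v₂, … with lᵢ = lsib vᵢ.
Chain : ℕ → Set
Chain n = Fin n × List (Fin n × ℕ)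

module _ {n : ℕ} where

  source target : Link n → Fin n
  source = proj₁
  target = proj₁ ∘ proj₂

  nodes : Chain n → List (Fin n)
  nodes (h , ps) = h ∷ map proj₁ ps

  lastNode : Chain n → Fin n
  lastNode (h , ps) = lastOf h (map proj₁ ps)

  linksFrom : Fin n → List (Fin n × ℕ) → List (Link n)
  linksFrom a []             = []
  linksFrom a ((b , l) ∷ ps) = (a , b , l) ∷ linksFrom b ps

  links : Chain n → List (Link n)
  links (h , ps) = linksFrom h ps

  nodes≡sources++last : ∀ h ps → nodes (h , ps) ≡ map source (links (h , ps)) ++ [ lastNode (h , ps) ]
  nodes≡sources++last h []            = refl
  nodes≡sources++last h ((b , l) ∷ ps) = cong (h ∷_) (nodes≡sources++last b ps)

  nodes≡head∷targets : ∀ h ps → nodes (h , ps) ≡ [ h ] ++ map target (links (h , ps))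
  nodes≡head∷targets h []            = refl
  nodes≡head∷targets h ((b , l) ∷ ps) = cong (h ∷_) (nodes≡head∷targets b ps)

  T-any-≟ : ∀ (f : I → Fin n) xs {v} → T (any (λ x → ⌊ f x ≟ᶠ v ⌋) xs) ⇔ ∃ (λ x → x ∈ xs × f x ≡ v)
  T-any-≟ f xs = mk⇔
    (λ t → let x , x∈ , fx≟v = find (any⁻ _ xs t) in x , x∈ , toWitness fx≟v)
    (λ (x , x∈ , fx≡v) → any⁺ _ (lose x∈ (fromWitness fx≡v)))

  -- Puts u, whose cadet is v, in front of the chain starting at v.
  attach : Fin n → Fin n → ℕ → List (Chain n) → List (Chain n)
  attach u v l []             = []
  attach u v l ((h , ps) ∷ Cs) with h ≟ᶠ v
  ... | yes _ = (u , (v , l) ∷ ps) ∷ Cs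
  ... | no  _ = (h , ps) ∷ attach u v l Cs

  module _ {u v : Fin n} {l : ℕ} where

    attach-head : ∀ {Cs} → v ∈ map proj₁ Cs → u ∈ map proj₁ (attach u v l Cs)
    attach-head {(h , ps) ∷ Cs} v∈ with h ≟ᶠ v | v∈
    ... | yes _   | _           = here refl
    ... | no  h≢v | here refl   = ⊥-elim (h≢v refl)
    ... | no  _   | there v∈Cs  = there (attach-head v∈Cs)

    attach-concatMap : ∀ (f : Chain n → List A) new →
      (∀ ps → f (u , (v , l) ∷ ps) ≡ new ∷ f (v , ps)) →
      ∀ {Cs} → v ∈ map proj₁ Cs → concatMap f (attach u v l Cs) ↭ new ∷ concatMap f Cs
    attach-concatMap f new f-∷ {(h , ps) ∷ Cs} v∈ with h ≟ᶠ v | v∈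
    ... | yes refl | _          = ↭.↭-reflexive (cong (_++ concatMap f Cs) (f-∷ ps))
    ... | no  h≢v  | here refl  = ⊥-elim (h≢v refl)
    ... | no  _    | there v∈Cs =
      ↭.trans (++⁺ˡ (f (h , ps)) (attach-concatMap f new f-∷ v∈Cs)) (shift new (f (h , ps)) _)

module _ {n m : ℕ} where

  mutual
    chains : Tree n m → List (Chain n)
    chains leaf = []
    chains (node u cs) with rightmostNode 0 cs
    ... | just (v , l) = attach u v l (chainsᵛ cs)
    ... | nothing      = (u , []) ∷ chainsᵛ cs

    chainsᵛ : ∀ {k} → Vec (Tree n m) k → List (Chain n)
    chainsᵛ []       = []
    chainsᵛ (c ∷ cs) = chains c ++ chainsᵛ cs

  mutual
    root-head : ∀ u (cs : Vec (Tree n m) (suc m)) → u ∈ map proj₁ (chains (node u cs))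
    root-head u cs with rightmostNode 0 cs in eq
    ... | just (v , l) = attach-head (rightmostNode-head 0 cs eq)
    ... | nothing      = here refl

    rightmostNode-head : ∀ {k} i (cs : Vec (Tree n m) k) {v l} →
      rightmostNode i cs ≡ just (v , l) → v ∈ map proj₁ (chainsᵛ cs)
    rightmostNode-head i (c ∷ cs) eq with rightmostNode (suc i) cs in eq′
    rightmostNode-head i (c ∷ cs) refl | just _ =
      subst (_ ∈_) (sym (map-++ proj₁ (chains c) (chainsᵛ cs)))
            (∈-++⁺ʳ (map proj₁ (chains c)) (rightmostNode-head (suc i) cs eq′))
    rightmostNode-head i (node v ds ∷ cs) refl | nothing =
      subst (_ ∈_) (sym (map-++ proj₁ (chains (node v ds)) (chainsᵛ cs))) (∈-++⁺ˡ (root-head v ds))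

  mutual
    labels-↭-chains : ∀ (τ : Tree n m) → labels τ ↭ concatMap nodes (chains τ)
    labels-↭-chains leaf = ↭.refl
    labels-↭-chains (node u cs) with rightmostNode 0 cs in eq
    ... | just (v , l) = ↭.trans (↭.prep u (labels-↭-chainsᵛ cs))
      (↭.↭-sym (attach-concatMap nodes u (λ _ → refl) (rightmostNode-head 0 cs eq)))
    ... | nothing = ↭.prep u (labels-↭-chainsᵛ cs)

    labels-↭-chainsᵛ : ∀ {k} (cs : Vec (Tree n m) k) → labelsV cs ↭ concatMap nodes (chainsᵛ cs)
    labels-↭-chainsᵛ []       = ↭.refl
    labels-↭-chainsᵛ (c ∷ cs) = subst (labels c ++ labelsV cs ↭_)
      (sym (concatMap-++ nodes (chains c) (chainsᵛ cs))) (++⁺ (labels-↭-chains c) (labels-↭-chainsᵛ cs))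

  mutual
    cadetEdges-↭-chains : ∀ (τ : Tree n m) → cadetEdges τ ↭ concatMap links (chains τ)
    cadetEdges-↭-chains leaf = ↭.refl
    cadetEdges-↭-chains (node u cs) with rightmostNode 0 cs in eq
    ... | just (v , l) = ↭.trans (↭.prep (u , v , l) (cadetEdges-↭-chainsᵛ cs))
      (↭.↭-sym (attach-concatMap links (u , v , l) (λ _ → refl) (rightmostNode-head 0 cs eq)))
    ... | nothing = cadetEdges-↭-chainsᵛ cs

    cadetEdges-↭-chainsᵛ : ∀ {k} (cs : Vec (Tree n m) k) → cadetEdgesV cs ↭ concatMap links (chainsᵛ cs)
    cadetEdges-↭-chainsᵛ []       = ↭.refl
    cadetEdges-↭-chainsᵛ (c ∷ cs) = subst (cadetEdges c ++ cadetEdgesV cs ↭_)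
      (sym (concatMap-++ links (chains c) (chainsᵛ cs)))
      (++⁺ (cadetEdges-↭-chains c) (cadetEdges-↭-chainsᵛ cs))

  lookupCadet-∈ : ∀ {a b l} (es : List (Link n)) → Unique (map source es) → (a , b , l) ∈ es →
    lookupCadet {n} {m} a es ≡ just (b , l)
  lookupCadet-∈ {a} ((w , v , l) ∷ es) (a∉ ∷ u) e∈ with a ≟ᶠ w | e∈
  ... | yes refl | here refl   = refl
  ... | yes refl | there e∈es  = ⊥-elim (All.lookup a∉ (∈-map⁺ source e∈es) refl)
  ... | no  a≢w  | here refl   = ⊥-elim (a≢w refl)
  ... | no  _    | there e∈es  = lookupCadet-∈ es u e∈es

  lookupCadet-∉ : ∀ a (es : List (Link n)) → ¬ a ∈ map source es → lookupCadet {n} {m} a es ≡ nothing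
  lookupCadet-∉ a []                 _  = refl
  lookupCadet-∉ a ((w , v , l) ∷ es) a∉ with a ≟ᶠ w
  ... | yes refl = ⊥-elim (a∉ (here refl))
  ... | no  _    = lookupCadet-∉ a es (a∉ ∘ there)

  module _ (τ : Tree n m) where

    isNode⇔∈ : ∀ {u} → T (isNode τ u) ⇔ u ∈ labels τ
    isNode⇔∈ {u} = mk⇔
      (λ t → let w , w∈ , w≡u = Equivalence.to (T-any-≟ (λ w → w) (labels τ)) t
             in subst (_∈ labels τ) w≡u w∈)
      (λ u∈ → Equivalence.from (T-any-≟ (λ w → w) (labels τ)) (u , u∈ , refl))

    isCadetOfSome⇔ : ∀ {v} → T (isCadetOfSome τ v) ⇔ ∃ (λ e → e ∈ cadetEdges τ × target e ≡ v)
    isCadetOfSome⇔ = T-any-≟ target (cadetEdges τ)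

    no-cadet⇔ : ∀ {u} → T (not (hasCadet τ u)) ⇔ cadet τ u ≡ nothing
    no-cadet⇔ {u} = mk⇔ to from
      where
      to : T (not (hasCadet τ u)) → cadet τ u ≡ nothing
      to t with cadet τ u
      ... | nothing = refl
      from : cadet τ u ≡ nothing → T (not (hasCadet τ u))
      from eq with cadet τ u
      from refl | nothing = _

    isCadetSeq⁺ : ∀ u us {ps} → chain τ u us ≡ just ps → T (isNode τ u) → T (isCadetSeq τ (u ∷ us))
    isCadetSeq⁺ u us eq t with chain τ u us
    isCadetSeq⁺ u us refl t | just _ = t

    isCadetSeq⁻ : ∀ u us → T (isCadetSeq τ (u ∷ us)) → ∃ (λ ps → chain τ u us ≡ just ps) × T (isNode τ u)
    isCadetSeq⁻ u us t with chain τ u us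
    ... | just ps = (ps , refl) , t

    isSCadetSeq⁻ : ∀ S u us → T (isSCadetSeq S τ (u ∷ us)) →
      ∃ (λ ps → chain τ u us ≡ just ps) × T (isNode τ u)
    isSCadetSeq⁻ S u us t with chain τ u us
    ... | just ps = (ps , refl) , proj₁ (Equivalence.to T-∧ t)

    chain-∷⁻ : ∀ {u v vs ps} → chain τ u (v ∷ vs) ≡ just ps →
      ∃ (λ l → cadet τ u ≡ just (v , l)) × ∃ (λ ps′ → chain τ v vs ≡ just ps′)
    chain-∷⁻ {u} {v} {vs} eq with cadet τ u
    ... | just (w , l) with w ≟ᶠ v
    ...   | yes refl with chain τ w vs
    ...     | just ps′ = (l , refl) , (ps′ , refl)

    chain-linksFrom : ∀ h ps → (∀ {e} → e ∈ linksFrom h ps → cadet τ (source e) ≡ just (proj₂ e)) →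
      chain τ h (map proj₁ ps) ≡ just ps
    chain-linksFrom h []             _      = refl
    chain-linksFrom h ((b , l) ∷ ps) cadets rewrite cadets (here refl) with b ≟ᶠ b
    ... | no  b≢b = ⊥-elim (b≢b refl)
    ... | yes _ rewrite chain-linksFrom b ps (cadets ∘ there) = refl

    chain-unique : ∀ u us vs {ps qs} → chain τ u us ≡ just ps → chain τ u vs ≡ just qs →
      cadet τ (lastOf u us) ≡ nothing → cadet τ (lastOf u vs) ≡ nothing → us ≡ vs
    chain-unique u []       []       _  _  _    _    = refl
    chain-unique u []       (v ∷ vs) _  e₂ end₁ _
      with (_ , c) , _ ← chain-∷⁻ e₂ with () ← trans (sym end₁) c
    chain-unique u (v ∷ us) []       e₁ _  _    end₂
      with (_ , c) , _ ← chain-∷⁻ e₁ with () ← trans (sym end₂) c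
    chain-unique u (v ∷ us) (v′ ∷ vs) e₁ e₂ end₁ end₂
      with (_ , c) , (_ , e₁′) ← chain-∷⁻ e₁ | (_ , c′) , (_ , e₂′) ← chain-∷⁻ e₂
      with refl ← trans (sym c) c′
      = cong (v ∷_) (chain-unique v us vs e₁′ e₂′ end₁ end₂)

module ChainDecomposition {n m : ℕ} (τ : Tree n m) (unique-labels : Unique (labels τ)) where

  Cs : List (Chain n)
  Cs = chains τ

  unique-nodes : Unique (concatMap nodes Cs)
  unique-nodes = Unique-resp-↭ (labels-↭-chains τ) unique-labels

  private
    unique-regrouped : ∀ (f g : Chain n → List (Fin n)) → (∀ C → nodes C ≡ f C ++ g C) →
      Unique (concatMap f Cs ++ concatMap g Cs)
    unique-regrouped f g split = Unique-resp-↭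
      (↭.trans (↭.↭-reflexive (cong concat (map-cong split Cs))) (concatMap-++-↭ f g Cs)) unique-nodes

    unique-sources-lasts : Unique (concatMap (map source ∘ links) Cs ++ concatMap ([_] ∘ lastNode) Cs)
    unique-sources-lasts = unique-regrouped _ _ (uncurry nodes≡sources++last)

    unique-heads-targets : Unique (concatMap ([_] ∘ proj₁) Cs ++ concatMap (map target ∘ links) Cs)
    unique-heads-targets = unique-regrouped _ _ (uncurry nodes≡head∷targets)

    sources-↭ : map source (cadetEdges τ) ↭ concatMap (map source ∘ links) Cs
    sources-↭ = ↭.trans (↭-map⁺ source (cadetEdges-↭-chains τ))
                        (↭.↭-reflexive (map-concatMap source links Cs))

    ∈-targets : ∀ {e} → e ∈ cadetEdges τ → target e ∈ concatMap (map target ∘ links) Cs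
    ∈-targets e∈ = subst (_ ∈_) (map-concatMap target links Cs)
      (∈-map⁺ target (∈-resp-↭ (cadetEdges-↭-chains τ) e∈))

  cadet-link : ∀ {e} → e ∈ cadetEdges τ → cadet τ (source e) ≡ just (proj₂ e)
  cadet-link = lookupCadet-∈ {m = m} (cadetEdges τ)
    (Unique-resp-↭ (↭.↭-sym sources-↭) (Unique-++⁻ˡ _ unique-sources-lasts))

  link-∈ : ∀ {C e} → C ∈ Cs → e ∈ links C → e ∈ cadetEdges τ
  link-∈ C∈ e∈ = ∈-resp-↭ (↭.↭-sym (cadetEdges-↭-chains τ)) (∈-concat⁺′ e∈ (∈-map⁺ links C∈))

  cadet-lastNode : ∀ {C} → C ∈ Cs → cadet τ (lastNode C) ≡ nothing
  cadet-lastNode C∈ = lookupCadet-∉ {m = m} _ (cadetEdges τ) (λ last∈ →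
    Unique-++⇒disjoint _ unique-sources-lasts (∈-resp-↭ sources-↭ last∈)
                       (∈-concat⁺′ (here refl) (∈-map⁺ _ C∈)))

  head-not-target : ∀ {C e} → C ∈ Cs → e ∈ cadetEdges τ → target e ≢ proj₁ C
  head-not-target C∈ e∈ eq = Unique-++⇒disjoint _ unique-heads-targets
    (∈-concat⁺′ (here refl) (∈-map⁺ _ C∈)) (subst (_∈ _) eq (∈-targets e∈))

  chain-nodes : ∀ {C} → C ∈ Cs → chain τ (proj₁ C) (map proj₁ (proj₂ C)) ≡ just (proj₂ C)
  chain-nodes {h , ps} C∈ = chain-linksFrom τ h ps (cadet-link ∘ link-∈ C∈)

  node-chain : ∀ {u} → u ∈ labels τ → ∃ λ C → C ∈ Cs × u ∈ nodes C
  node-chain u∈ = find (∈-concatMap⁻ nodes (∈-resp-↭ (labels-↭-chains τ) u∈))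

  cadet-closed : ∀ {C a c l} → C ∈ Cs → a ∈ nodes C → cadet τ a ≡ just (c , l) → c ∈ nodes C
  cadet-closed {C} {a} C∈ a∈ cadet≡
    with ∈-++⁻ (map source (links C)) (subst (a ∈_) (uncurry nodes≡sources++last C) a∈)
  ... | inj₂ (here refl) with () ← trans (sym (cadet-lastNode C∈)) cadet≡
  ... | inj₁ a∈sources
    with e , e∈ , refl ← ∈-map⁻ source a∈sources
    with refl ← trans (sym cadet≡) (cadet-link (link-∈ C∈ e∈))
    = subst (target e ∈_) (sym (uncurry nodes≡head∷targets C)) (there (∈-map⁺ target e∈))

  chain-closed : ∀ {C u us ps} → C ∈ Cs → chain τ u us ≡ just ps → u ∈ nodes C → All (_∈ nodes C) us
  chain-closed {us = []}     _  _   _  = []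
  chain-closed {us = v ∷ vs} C∈ eq u∈ with (_ , cadet≡) , (_ , eq′) ← chain-∷⁻ τ eq =
    let v∈ = cadet-closed C∈ u∈ cadet≡ in v∈ ∷ chain-closed C∈ eq′ v∈

  nodes-isMaxCadetSeq : ∀ {C} → C ∈ Cs → T (isMaxCadetSeq τ (nodes C))
  nodes-isMaxCadetSeq {h , ps} C∈ = Equivalence.from T-∧ (is-seq , Equivalence.from T-∧ (ends , starts))
    where
    is-seq : T (isCadetSeq τ (h ∷ map proj₁ ps))
    is-seq = isCadetSeq⁺ τ h (map proj₁ ps) (chain-nodes C∈) (Equivalence.from (isNode⇔∈ τ)
      (∈-resp-↭ (↭.↭-sym (labels-↭-chains τ)) (∈-concat⁺′ (here refl) (∈-map⁺ nodes C∈))))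
    ends : T (not (hasCadet τ (lastNode (h , ps))))
    ends = Equivalence.from (no-cadet⇔ τ) (cadet-lastNode C∈)
    starts : T (not (isCadetOfSome τ h))
    starts = T-not⁺ (λ t → let e , e∈ , target≡h = Equivalence.to (isCadetOfSome⇔ τ) t
                           in head-not-target C∈ e∈ target≡h)

  isMaxCadetSeq-nodes : ∀ X → T (isMaxCadetSeq τ X) → X ∈ map nodes Cs
  isMaxCadetSeq-nodes []       ()
  isMaxCadetSeq-nodes (u ∷ us) t
    with is-seq , rest ← Equivalence.to (T-∧ {isCadetSeq τ (u ∷ us)}) t
    with ends , starts ← Equivalence.to T-∧ rest
    with (_ , chain≡) , u-node ← isCadetSeq⁻ τ u us is-seq
    with (h , ps) , C∈ , u∈C ← node-chain (Equivalence.to (isNode⇔∈ τ) u-node)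
    with u∈C
  ... | there u∈targets
    with e , e∈ , refl ← ∈-map⁻ target (subst (_ ∈_) (∷-injectiveʳ (nodes≡head∷targets h ps)) u∈targets)
    = ⊥-elim (T-not⁻ starts (Equivalence.from (isCadetOfSome⇔ τ) (e , link-∈ C∈ e∈ , refl)))
  ... | here refl = subst (_∈ map nodes Cs)
    (cong (h ∷_) (chain-unique τ h (map proj₁ ps) us (chain-nodes C∈) chain≡
                    (cadet-lastNode C∈) (Equivalence.to (no-cadet⇔ τ) ends)))
    (∈-map⁺ nodes C∈)

  isSBlock-clustered : ∀ S → WeightedPartitions.Clustered (signedWeight (isSBlock S τ)) (map nodes Cs)
  isSBlock-clustered S b {a} {c} a∈b c∈b _ _ with isSBlock S τ b in ok
  ... | false = inj₁ refl
  ... | true with find (any⁻ (isSCadetSeq S τ) (perms b) (subst T (sym ok) _))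
  ...   | [] , _ , ()
  ...   | u ∷ us , L∈ , L-seq
    with (_ , chain≡) , u-node ← isSCadetSeq⁻ τ S u us L-seq
    with C , C∈ , u∈C ← node-chain (Equivalence.to (isNode⇔∈ τ) u-node)
    = inj₂ (Any-map⁺ (lose C∈ (in-C a∈b , in-C c∈b)))
    where
    in-C : ∀ {y} → y ∈ b → y ∈ nodes C
    in-C y∈b = All.lookup (u∈C ∷ chain-closed C∈ chain≡ u∈C) (∈-resp-↭ (↭.↭-sym (∈-perms⁻ b L∈)) y∈b)

  nodes-↭-maximal : ∀ Xs → Unique Xs → (∀ X → (X ∈ Xs) ⇔ T (isMaxCadetSeq τ X)) → map nodes Cs ↭ Xs
  nodes-↭-maximal Xs unique-Xs enumerates = ∼bag⇒↭ (unique∧set⇒bag unique-chains unique-Xs (λ {X} → mk⇔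
    (λ X∈ → let C , C∈ , X≡ = ∈-map⁻ nodes X∈
            in subst (_∈ Xs) (sym X≡) (Equivalence.from (enumerates (nodes C)) (nodes-isMaxCadetSeq C∈)))
    (λ X∈ → isMaxCadetSeq-nodes X (Equivalence.to (enumerates X) X∈))))
    where
    unique-chains : Unique (map nodes Cs)
    unique-chains = Unique-concat⁻ (map nodes Cs) unique-nodes
      (All.map⁺ (All.universal (λ (h , _) → h , here refl) Cs))

lemma3p6 : (n : ℕ) (S : Family n) (τ : Tree n (mOf S))
    → labels τ ↭ allFin n
    → (Xs : List (List (Fin n)))
    → Unique Xs
    → (∀ X → (X ∈ Xs) ⇔ T (isMaxCadetSeq τ X))
    → rTree S τ ≡ productℤ (map (rSeq S τ) Xs)
lemma3p6 n S τ labels↭ Xs unique-Xs enumerates = begin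
  rTree S τ
    ≡⟨ cong (λ k → ∑ (sBoxings S τ (labels τ)) (λ P → -1ℤ ^ (k ∸ length P))) length-labels ⟨
  ∑ (sBoxings S τ (labels τ)) (λ P → -1ℤ ^ (length (labels τ) ∸ length P))
    ≡⟨ ∑-signedBoxings (isSBlock S τ) (labels τ) ⟩
  F (labels τ)
    ≡⟨ F-↭ (signedWeight-↭ _ (any-perms-↭ (isSCadetSeq S τ))) (labels-↭-chains τ) ⟩
  F (concat (map nodes Cs))
    ≡⟨ F-concat (map nodes Cs) unique-nodes (isSBlock-clustered S) ⟩
  productℤ (map F (map nodes Cs))
    ≡⟨ productℤ-↭ (↭-map⁺ F (nodes-↭-maximal Xs unique-Xs enumerates)) ⟩
  productℤ (map F Xs)
    ≡⟨ cong productℤ (map-cong (∑-signedBoxings (isSBlock S τ)) Xs) ⟨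
  productℤ (map (rSeq S τ) Xs) ∎
  where
  open ≡-Reasoning
  open ChainDecomposition τ (Unique-resp-↭ (↭.↭-sym labels↭) (allFin⁺ n))
  open WeightedPartitions (signedWeight (isSBlock S τ))
  length-labels : length (labels τ) ≡ n
  length-labels = trans (↭-length labels↭) (length-tabulate (λ i → i))
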